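{- Let $C'\subseteq\{0,1\}^n$, let $r$ and $s$ be generalized readers such that $r$ contains $s$, let $J\subseteq[n]$ and $y\in\{0,1\}^J$ with $\{c\in C':c[J]=y\}\ne\emptyset$. If $s$ is a $J$-discerning reader for $y$, then so is $r$.
   Context: A generalized reader is a sequence $r_0,\dots,r_{n-1}$ of functions $r_i:\{0,1\}^i\to\{1,\dots,n\}\cup\{\star\}$ such that for all $i<j$ and $y\in\{0,1\}^j$, either $r_i(y_1,\dots,y_i)\in\{1,\dots,n\}\setminus\{r_j(y)\}$, or $r_i(y_1,\dots,y_i)=r_j(y)=\star$. The reading $R_{r(x)}$ of $x\in\{0,1\}^n$ is the finite sequence $y_1,\dots,y_m$ defined by $y_{i+1}=x_{r_i(y_1,\dots,y_i)}$, where $m$ is the least index with $r_m(y_1,\dots,y_m)=\star$ (or $m=n$ if there is none). $r$ contains $s$ if for every $x\in\{0,1\}^n$, $R_{s(x)}$ is a prefix of $R_{r(x)}$. For $J\subseteq[n]$ and $y\in\{0,1\}^J$, $S(r,y,J)$ is the distribution of $R_{r(x')}$ where $x'$ agrees with $y$ on $J$ and its other coordinates are independent uniform bits. With $x$ uniform on $\{c\in C':c[J]=y\}$ (where $c[J]$ is the restriction of $c$ to $J$), $r$ is a $J$-discerning reader for $y$ if $d_{TV}(R_{r(x)},S(r,y,J))\ge 1/8$, where $d_{TV}(p,q)=\frac12\sum_a|p(a)-q(a)|$ over finite binary strings $a$. -}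

module Defs where

open import Data.Bool using (Bool; true; false; _∧_; if_then_else_)
open import Data.Nat as ℕ using (ℕ; zero; suc; _≤_; z≤n; s≤s; _<?_)
open import Data.Fin as Fin using (Fin; toℕ; fromℕ<)
open import Data.Fin.Properties using (toℕ-fromℕ<)
open import Data.Nat.Properties using (<⇒≤)
open import Data.Fin.Subset using (Subset; _∈_)
open import Data.Fin.Subset.Properties using (_∈?_)
open import Data.Vec as Vec using (Vec; []; _∷_; _∷ʳ_; lookup; toList; cast)
open import Data.List as List using (List; []; _∷_; _++_; length; concat; map; upTo; filter)
open import Data.List.Properties using (≡-dec)
open import Data.Maybe using (Maybe; just; nothing)
open import Data.Product using (Σ; ∃; _×_; _,_)
open import Data.Sum using (_⊎_)
open import Data.Integer using (+_)
open import Data.Rational as ℚ using (ℚ; 0ℚ; ½; ∣_∣; _-_)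
import Data.Bool.Properties as BoolP
open import Relation.Nullary using (yes; no; ¬_)
open import Relation.Nullary.Decidable using (⌊_⌋)
open import Relation.Binary.PropositionalEquality using (_≡_; _≢_; sym)

-- A candidate reader on n coordinates: r_i : {0,1}^i → [n] ∪ {⋆} for i = 0,…,n-1,
-- with ⋆ represented by nothing and coordinate j ∈ [n] by just j (0-indexed Fin n).
Reader : ℕ → Set
Reader n = (i : Fin n) → Vec Bool (toℕ i) → Maybe (Fin n)

prefixV : ∀ {A : Set} {m k : ℕ} → m ≤ k → Vec A k → Vec A m
prefixV z≤n       _        = []
prefixV (s≤s p)   (a ∷ as) = a ∷ prefixV p as

IsGeneralizedReader : ∀ {n} → Reader n → Set
IsGeneralizedReader {n} r =
  (i j : Fin n) (i<j : i Fin.< j) (w : Vec Bool (toℕ j)) →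
    (∃ λ k → r i (prefixV (<⇒≤ i<j) w) ≡ just k × r j w ≢ just k)
    ⊎ (r i (prefixV (<⇒≤ i<j) w) ≡ nothing × r j w ≡ nothing)

readFrom : ∀ {n} → Reader n → Vec Bool n → ℕ → (i : ℕ) → Vec Bool i → List Bool
readFrom r x zero    i y = toList y
readFrom {n} r x (suc f) i y with i <? n
... | no _ = toList y
... | yes p with r (fromℕ< p) (cast (sym (toℕ-fromℕ< p)) y)
...   | nothing = toList y
...   | just k  = readFrom r x f (suc i) (y ∷ʳ lookup x k)

reading : ∀ {n} → Reader n → Vec Bool n → List Bool
reading {n} r x = readFrom r x n 0 []

Contains : ∀ {n} → Reader n → Reader n → Set
Contains {n} r s = (x : Vec Bool n) → ∃ λ t → reading s x ++ t ≡ reading r x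

allVecs : (k : ℕ) → List (Vec Bool k)
allVecs zero    = [] ∷ []
allVecs (suc k) = concat (map (λ v → (false ∷ v) ∷ (true ∷ v) ∷ []) (allVecs k))

-- all binary strings of length ≤ n (these contain the support of any reading)
allStrings : ℕ → List (List Bool)
allStrings n = concat (map (λ k → map toList (allVecs k)) (upTo (suc n)))

Partial : ∀ {n} → Subset n → Set
Partial {n} J = (i : Fin n) → i ∈ J → Bool

agrees : ∀ {n} (J : Subset n) → Partial J → Vec Bool n → Bool
agrees {n} J y c = List.foldr (λ i b → test i ∧ b) true (List.allFin n)
  where
  test : Fin n → Bool
  test i with i ∈? J
  ... | yes p = ⌊ lookup c i BoolP.≟ y i p ⌋
  ... | no _  = true

count : ∀ {A : Set} → (A → Bool) → List A → ℕ
count P xs = length (filter (λ a → BoolP.T? (P a)) xs)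

-- m / d as a rational (0 if d = 0; never used with d = 0 below)
frac : ℕ → ℕ → ℚ
frac m zero    = 0ℚ
frac m (suc d) = + m ℚ./ suc d

sameString : List Bool → List Bool → Bool
sameString a b = ⌊ ≡-dec BoolP._≟_ a b ⌋

probC : ∀ {n} → (Vec Bool n → Bool) → (J : Subset n) → Partial J → Reader n → List Bool → ℚ
probC {n} C J y r a =
  frac (count (λ c → C c ∧ agrees J y c ∧ sameString (reading r c) a) (allVecs n))
       (count (λ c → C c ∧ agrees J y c) (allVecs n))

-- S(r,y,J)(a): x' agrees with y on J, other coordinates independent uniform bits
-- (equivalently x' uniform on the 2^{n-|J|} vectors agreeing with y on J)
probS : ∀ {n} → (J : Subset n) → Partial J → Reader n → List Bool → ℚ
probS {n} J y r a =
  frac (count (λ c → agrees J y c ∧ sameString (reading r c) a) (allVecs n))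
       (count (λ c → agrees J y c) (allVecs n))

sumℚ : List ℚ → ℚ
sumℚ = List.foldr ℚ._+_ 0ℚ

-- d_TV(R_{r(x)}, S(r,y,J)) (sum over all strings of length ≤ n; all others have mass 0)
tvDist : ∀ {n} → (Vec Bool n → Bool) → (J : Subset n) → Partial J → Reader n → ℚ
tvDist {n} C J y r =
  ½ ℚ.* sumℚ (map (λ a → ∣ probC C J y r a - probS J y r a ∣) (allStrings n))

Discerning : ∀ {n} → (Vec Bool n → Bool) → (J : Subset n) → Partial J → Reader n → Set
Discerning C J y r = (+ 1 ℚ./ 8) ℚ.≤ tvDist C J y r

-- Since r contains s, the reading of s is a deterministic function of the reading of r:
-- replay s, answering its i-th query by the i-th bit of r's reading.  The difference
-- between the law of the reading on C' and its law S(·,y,J) is the pushforward, along the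
-- reading, of one signed weight on {0,1}ⁿ, and the ℓ¹ norm of a pushforward can only
-- shrink under a further deterministic map (data processing).  Hence the total variation
-- distance of s is at most that of r.
module Submission where

open import Defs
open import Data.Bool using (Bool; true; false; _∧_)
import Data.Bool.Properties as BoolP
open import Data.Nat as ℕ using (ℕ; zero; suc; _≤_; z≤n; s≤s; _<?_)
import Data.Nat.Properties as ℕP
open import Data.Fin using (fromℕ<)
open import Data.Fin.Properties using (toℕ-fromℕ<)
open import Data.Fin.Subset using (Subset)
open import Data.Vec using (Vec; []; _∷_; _∷ʳ_; lookup; toList; cast)
import Data.Vec.Properties as VecP
open import Data.List as List using (List; []; _∷_; _++_; length; map; concat; upTo)
import Data.List.Properties as ListP
open import Data.List.Relation.Unary.Any using (here; there)
open import Data.List.Relation.Unary.AllPairs using (_∷_)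
open import Data.List.Relation.Unary.Unique.Propositional using (Unique)
open import Data.List.Relation.Unary.Unique.Propositional.Properties using (upTo⁺)
open import Data.List.Membership.Propositional using (_∈_; _∉_)
open import Data.List.Membership.Propositional.Properties using (∈-upTo⁺)
open import Data.List.Relation.Unary.All.Properties using (All¬⇒¬Any)
open import Data.Maybe using (just; nothing)
open import Data.Product using (Σ; ∃; _×_; _,_)
open import Data.Integer as ℤ using (ℤ)
open import Data.Integer.Tactic.RingSolver using (solve-∀)
import Data.Integer.Properties as ℤP
open import Data.Rational as ℚ using (ℚ; 0ℚ; ½; ∣_∣; _+_; _-_; -_)
import Data.Rational.Properties as ℚP
open import Data.Rational.Unnormalised as ℚᵘ using (mkℚᵘ; *≡*)
import Data.Rational.Unnormalised.Properties as ℚᵘP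
open import Algebra.Bundles using (CommutativeMonoid)
open import Algebra.Properties.CommutativeSemigroup
  (CommutativeMonoid.commutativeSemigroup ℚP.+-0-commutativeMonoid) using (interchange)
open import Relation.Nullary using (yes; no; contradiction)
open import Relation.Nullary.Decidable using (⌊_⌋; toWitness)
open import Function using (_∘_; Equivalence)
open import Relation.Binary.Definitions using (DecidableEquality)
open import Relation.Binary.PropositionalEquality

private variable A B : Set

∑ : List A → (A → ℚ) → ℚ
∑ xs g = sumℚ (map g xs)

∑-cong : (xs : List A) {g h : A → ℚ} → (∀ x → g x ≡ h x) → ∑ xs g ≡ ∑ xs h
∑-cong []       g≗h = refl
∑-cong (x ∷ xs) g≗h = cong₂ _+_ (g≗h x) (∑-cong xs g≗h)

∑-mono-≤ : (xs : List A) {g h : A → ℚ} → (∀ x → g x ℚ.≤ h x) → ∑ xs g ℚ.≤ ∑ xs h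
∑-mono-≤ []       g≤h = ℚP.≤-refl
∑-mono-≤ (x ∷ xs) g≤h = ℚP.+-mono-≤ (g≤h x) (∑-mono-≤ xs g≤h)

∑-zero : (xs : List A) → ∑ xs (λ _ → 0ℚ) ≡ 0ℚ
∑-zero []       = refl
∑-zero (x ∷ xs) = trans (ℚP.+-identityˡ _) (∑-zero xs)

∑-distrib-+ : (xs : List A) (g h : A → ℚ) → ∑ xs (λ x → g x + h x) ≡ ∑ xs g + ∑ xs h
∑-distrib-+ []       g h = refl
∑-distrib-+ (x ∷ xs) g h =
  trans (cong ((g x + h x) +_) (∑-distrib-+ xs g h)) (interchange (g x) (h x) (∑ xs g) (∑ xs h))

∑-distrib-neg : (xs : List A) (g : A → ℚ) → ∑ xs (λ x → - g x) ≡ - ∑ xs g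
∑-distrib-neg []       g = refl
∑-distrib-neg (x ∷ xs) g =
  trans (cong (- g x +_) (∑-distrib-neg xs g)) (sym (ℚP.neg-distrib-+ (g x) (∑ xs g)))

∑-distrib-- : (xs : List A) (g h : A → ℚ) → ∑ xs g - ∑ xs h ≡ ∑ xs (λ x → g x - h x)
∑-distrib-- xs g h = begin
  ∑ xs g - ∑ xs h                 ≡⟨ cong (∑ xs g +_) (∑-distrib-neg xs h) ⟨
  ∑ xs g + ∑ xs (λ x → - h x)     ≡⟨ ∑-distrib-+ xs g (λ x → - h x) ⟨
  ∑ xs (λ x → g x - h x)          ∎
  where open ≡-Reasoning

∑-comm : (xs : List A) (ys : List B) (g : A → B → ℚ) →
         ∑ xs (λ a → ∑ ys (g a)) ≡ ∑ ys (λ b → ∑ xs (λ a → g a b))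
∑-comm []       ys g = sym (∑-zero ys)
∑-comm (x ∷ xs) ys g =
  trans (cong (∑ ys (g x) +_) (∑-comm xs ys g)) (sym (∑-distrib-+ ys (g x) _))

∣∑∣≤∑∣∣ : (xs : List A) (g : A → ℚ) → ∣ ∑ xs g ∣ ℚ.≤ ∑ xs (λ x → ∣ g x ∣)
∣∑∣≤∑∣∣ []       g = ℚP.≤-refl
∣∑∣≤∑∣∣ (x ∷ xs) g =
  ℚP.≤-trans (ℚP.∣p+q∣≤∣p∣+∣q∣ (g x) (∑ xs g)) (ℚP.+-monoʳ-≤ ∣ g x ∣ (∣∑∣≤∑∣∣ xs g))

mask : Bool → ℚ → ℚ
mask true  q = q
mask false q = 0ℚ

mask-comm : ∀ b c q → mask b (mask c q) ≡ mask c (mask b q)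
mask-comm true  c     q = refl
mask-comm false true  q = refl
mask-comm false false q = refl

∣mask∣ : ∀ b q → ∣ mask b q ∣ ≡ mask b ∣ q ∣
∣mask∣ true  q = refl
∣mask∣ false q = refl

∑-mask : (xs : List A) (b : Bool) (g : A → ℚ) → ∑ xs (λ x → mask b (g x)) ≡ mask b (∑ xs g)
∑-mask xs true  g = refl
∑-mask xs false g = ∑-zero xs

∑-mask-count≡0 : (P : A → Bool) (xs : List A) (g : A → ℚ) →
                 count P xs ≡ 0 → ∑ xs (λ x → mask (P x) (g x)) ≡ 0ℚ
∑-mask-count≡0 P []       g _ = refl
∑-mask-count≡0 P (x ∷ xs) g c≡0 with P x
... | false = trans (ℚP.+-identityˡ _) (∑-mask-count≡0 P xs g c≡0)

∑-mask-count≡1 : (P : A → Bool) (xs : List A) (g : A → ℚ) (q : ℚ) →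
                 (∀ x → P x ≡ true → g x ≡ q) → count P xs ≡ 1 →
                 ∑ xs (λ x → mask (P x) (g x)) ≡ q
∑-mask-count≡1 P (x ∷ xs) g q gP≡q c≡1 with P x in Px
... | true  = trans (cong₂ _+_ (gP≡q x Px) (∑-mask-count≡0 P xs g (ℕP.suc-injective c≡1)))
                    (ℚP.+-identityʳ q)
... | false = trans (ℚP.+-identityˡ _) (∑-mask-count≡1 P xs g q gP≡q c≡1)

∑-mask-count≤1 : (P : A → Bool) (xs : List A) (q : ℚ) → 0ℚ ℚ.≤ q →
                 count P xs ≤ 1 → ∑ xs (λ x → mask (P x) q) ℚ.≤ q
∑-mask-count≤1 P xs q 0≤q c≤1 with count P xs in c
... | 0 = ℚP.≤-trans (ℚP.≤-reflexive (∑-mask-count≡0 P xs (λ _ → q) c)) 0≤q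
... | 1 = ℚP.≤-reflexive (∑-mask-count≡1 P xs (λ _ → q) q (λ _ _ → refl) c)
... | suc (suc _) with s≤s () ← c≤1

occurrences : DecidableEquality A → A → List A → ℕ
occurrences _≟_ a = count (λ b → ⌊ a ≟ b ⌋)

module _ (_≟_ : DecidableEquality A) where

  count-++ : (P : A → Bool) (xs ys : List A) → count P (xs ++ ys) ≡ count P xs ℕ.+ count P ys
  count-++ P xs ys =
    trans (cong length (ListP.filter-++ (λ a → BoolP.T? (P a)) xs ys)) (ListP.length-++ (List.filter _ xs))

  occurrences-∉ : ∀ {a xs} → a ∉ xs → occurrences _≟_ a xs ≡ 0
  occurrences-∉ {a} {[]}     a∉xs = refl
  occurrences-∉ {a} {b ∷ xs} a∉xs with a ≟ b
  ... | yes a≡b = contradiction (here a≡b) a∉xs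
  ... | no  _   = occurrences-∉ (λ a∈xs → a∉xs (there a∈xs))

  occurrences-Unique-≤1 : ∀ a {xs} → Unique xs → occurrences _≟_ a xs ≤ 1
  occurrences-Unique-≤1 a {[]}     _ = z≤n
  occurrences-Unique-≤1 a {b ∷ xs} (b∉xs ∷ xs!) with a ≟ b
  ... | yes refl = ℕP.≤-reflexive (cong suc (occurrences-∉ (All¬⇒¬Any b∉xs)))
  ... | no  _    = occurrences-Unique-≤1 a xs!

  occurrences-Unique-∈ : ∀ {a xs} → a ∈ xs → Unique xs → occurrences _≟_ a xs ≡ 1
  occurrences-Unique-∈ {a} (here refl) (a∉xs ∷ _) with a ≟ a
  ... | yes _   = cong suc (occurrences-∉ (All¬⇒¬Any a∉xs))
  ... | no  a≢a = contradiction refl a≢a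
  occurrences-Unique-∈ {a} {b ∷ _} (there a∈xs) (b∉xs ∷ xs!) with a ≟ b
  ... | yes refl = contradiction a∈xs (All¬⇒¬Any b∉xs)
  ... | no  _    = occurrences-Unique-∈ a∈xs xs!

module Pushforward {X B : Set} (_≟_ : DecidableEquality B) (D : List X) (w : X → ℚ) where

  pushforward : (X → B) → B → ℚ
  pushforward R b = ∑ D (λ x → mask ⌊ R x ≟ b ⌋ (w x))

  pushforward-cong : {R S : X → B} → (∀ x → R x ≡ S x) → ∀ b → pushforward R b ≡ pushforward S b
  pushforward-cong R≗S b = ∑-cong D (λ x → cong (λ c → mask ⌊ c ≟ b ⌋ (w x)) (R≗S x))

  module _ (L : List B) (R : X → B) (R∈L : ∀ x → occurrences _≟_ (R x) L ≡ 1) where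

    pushforward-∘ : (f : B → B) (a : B) →
                    pushforward (f ∘ R) a ≡ ∑ L (λ b → mask ⌊ f b ≟ a ⌋ (pushforward R b))
    pushforward-∘ f a = begin
      pushforward (f ∘ R) a
        ≡⟨ ∑-cong D (λ x → sym (∑-mask-count≡1 (λ b → ⌊ R x ≟ b ⌋) L (λ b → mask ⌊ f b ≟ a ⌋ (w x)) _
                                  (λ b Rx≟b → cong (λ c → mask ⌊ f c ≟ a ⌋ (w x))
                                                   (sym (toWitness (Equivalence.from BoolP.T-≡ Rx≟b))))
                                  (R∈L x))) ⟩
      ∑ D (λ x → ∑ L (λ b → mask ⌊ R x ≟ b ⌋ (mask ⌊ f b ≟ a ⌋ (w x))))
        ≡⟨ ∑-comm D L _ ⟩
      ∑ L (λ b → ∑ D (λ x → mask ⌊ R x ≟ b ⌋ (mask ⌊ f b ≟ a ⌋ (w x))))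
        ≡⟨ ∑-cong L (λ b → trans (∑-cong D (λ x → mask-comm ⌊ R x ≟ b ⌋ ⌊ f b ≟ a ⌋ (w x)))
                                 (∑-mask D ⌊ f b ≟ a ⌋ _)) ⟩
      ∑ L (λ b → mask ⌊ f b ≟ a ⌋ (pushforward R b)) ∎
      where open ≡-Reasoning

    ∑∣pushforward-∘∣≤∑∣pushforward∣ : (f : B → B) → (∀ b → occurrences _≟_ b L ≤ 1) →
      ∑ L (λ a → ∣ pushforward (f ∘ R) a ∣) ℚ.≤ ∑ L (λ b → ∣ pushforward R b ∣)
    ∑∣pushforward-∘∣≤∑∣pushforward∣ f L-unique = begin
      ∑ L (λ a → ∣ pushforward (f ∘ R) a ∣)
        ≡⟨ ∑-cong L (λ a → cong ∣_∣ (pushforward-∘ f a)) ⟩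
      ∑ L (λ a → ∣ ∑ L (λ b → mask ⌊ f b ≟ a ⌋ (pushforward R b)) ∣)
        ≤⟨ ∑-mono-≤ L (λ a → ∣∑∣≤∑∣∣ L _) ⟩
      ∑ L (λ a → ∑ L (λ b → ∣ mask ⌊ f b ≟ a ⌋ (pushforward R b) ∣))
        ≡⟨ ∑-cong L (λ a → ∑-cong L (λ b → ∣mask∣ ⌊ f b ≟ a ⌋ (pushforward R b))) ⟩
      ∑ L (λ a → ∑ L (λ b → mask ⌊ f b ≟ a ⌋ ∣ pushforward R b ∣))
        ≡⟨ ∑-comm L L _ ⟩
      ∑ L (λ b → ∑ L (λ a → mask ⌊ f b ≟ a ⌋ ∣ pushforward R b ∣))
        ≤⟨ ∑-mono-≤ L (λ b → ∑-mask-count≤1 _ L _ (ℚP.0≤∣p∣ _) (L-unique (f b))) ⟩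
      ∑ L (λ b → ∣ pushforward R b ∣) ∎
      where open ℚP.≤-Reasoning

_≟ₛ_ : DecidableEquality (List Bool)
_≟ₛ_ = ListP.≡-dec BoolP._≟_

stringsOfLength : ℕ → List (List Bool)
stringsOfLength k = map toList (allVecs k)

occurrences-extensions : ∀ {k} b t (vs : List (Vec Bool k)) →
  occurrences _≟ₛ_ (b ∷ t) (map toList (concat (map (λ v → (false ∷ v) ∷ (true ∷ v) ∷ []) vs)))
  ≡ occurrences _≟ₛ_ t (map toList vs)
occurrences-extensions b t [] = refl
occurrences-extensions false t (v ∷ vs) with t ≟ₛ toList v
... | yes _ = cong suc (occurrences-extensions false t vs)
... | no  _ = occurrences-extensions false t vs
occurrences-extensions true t (v ∷ vs) with t ≟ₛ toList v
... | yes _ = cong suc (occurrences-extensions true t vs)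
... | no  _ = occurrences-extensions true t vs

occurrences-[]-nonempty : ∀ {k} (vs : List (Vec Bool (suc k))) → occurrences _≟ₛ_ [] (map toList vs) ≡ 0
occurrences-[]-nonempty []             = refl
occurrences-[]-nonempty ((_ ∷ _) ∷ vs) = occurrences-[]-nonempty vs

occurrences-suc-singleton : ∀ l k →
  occurrences ℕ._≟_ (suc l) (suc k ∷ []) ≡ occurrences ℕ._≟_ l (k ∷ [])
occurrences-suc-singleton l k with l ℕ.≟ k | suc l ℕ.≟ suc k
... | yes _    | yes _  = refl
... | no  _    | no  _  = refl
... | yes refl | no 1+l≢1+l = contradiction refl 1+l≢1+l
... | no  l≢k  | yes 1+l≡1+k = contradiction (ℕP.suc-injective 1+l≡1+k) l≢k

occurrences-stringsOfLength : ∀ t k →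
  occurrences _≟ₛ_ t (stringsOfLength k) ≡ occurrences ℕ._≟_ (length t) (k ∷ [])
occurrences-stringsOfLength []      zero    = refl
occurrences-stringsOfLength (_ ∷ _) zero    = refl
occurrences-stringsOfLength []      (suc k) = occurrences-[]-nonempty (allVecs (suc k))
occurrences-stringsOfLength (b ∷ t) (suc k) =
  trans (occurrences-extensions b t (allVecs k))
        (trans (occurrences-stringsOfLength t k) (sym (occurrences-suc-singleton (length t) k)))

occurrences-concat-stringsOfLength : ∀ t ks →
  occurrences _≟ₛ_ t (concat (map stringsOfLength ks)) ≡ occurrences ℕ._≟_ (length t) ks
occurrences-concat-stringsOfLength t []       = refl
occurrences-concat-stringsOfLength t (k ∷ ks) = begin
  occurrences _≟ₛ_ t (stringsOfLength k ++ concat (map stringsOfLength ks))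
    ≡⟨ count-++ _≟ₛ_ _ (stringsOfLength k) _ ⟩
  occurrences _≟ₛ_ t (stringsOfLength k) ℕ.+ occurrences _≟ₛ_ t (concat (map stringsOfLength ks))
    ≡⟨ cong₂ ℕ._+_ (occurrences-stringsOfLength t k) (occurrences-concat-stringsOfLength t ks) ⟩
  occurrences ℕ._≟_ (length t) (k ∷ []) ℕ.+ occurrences ℕ._≟_ (length t) ks
    ≡⟨ count-++ ℕ._≟_ _ (k ∷ []) ks ⟨
  occurrences ℕ._≟_ (length t) (k ∷ ks) ∎
  where open ≡-Reasoning

occurrences-allStrings-≤1 : ∀ n t → occurrences _≟ₛ_ t (allStrings n) ≤ 1
occurrences-allStrings-≤1 n t = ℕP.≤-trans
  (ℕP.≤-reflexive (occurrences-concat-stringsOfLength t (upTo (suc n))))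
  (occurrences-Unique-≤1 ℕ._≟_ (length t) (upTo⁺ (suc n)))

occurrences-allStrings : ∀ n t → length t ≤ n → occurrences _≟ₛ_ t (allStrings n) ≡ 1
occurrences-allStrings n t ∣t∣≤n = trans
  (occurrences-concat-stringsOfLength t (upTo (suc n)))
  (occurrences-Unique-∈ ℕ._≟_ (∈-upTo⁺ (s≤s ∣t∣≤n)) (upTo⁺ (suc n)))

-- Out-of-range positions give false; replay run on an extension of its own reading never reads one.
bitAt : List Bool → ℕ → Bool
bitAt []       _       = false
bitAt (b ∷ _)  zero    = b
bitAt (_ ∷ bs) (suc i) = bitAt bs i

bitAt-toList-∷ʳ : ∀ {i} (y : Vec Bool i) b rest → bitAt (toList (y ∷ʳ b) ++ rest) i ≡ b
bitAt-toList-∷ʳ []      b rest = refl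
bitAt-toList-∷ʳ (_ ∷ y) b rest = bitAt-toList-∷ʳ y b rest

-- readFrom, with the i-th query answered by the i-th bit of a instead of by x.
replay : ∀ {n} → Reader n → List Bool → ℕ → (i : ℕ) → Vec Bool i → List Bool
replay s a zero    i y = toList y
replay {n} s a (suc f) i y with i <? n
... | no _ = toList y
... | yes i<n with s (fromℕ< i<n) (cast (sym (toℕ-fromℕ< i<n)) y)
...   | nothing = toList y
...   | just _  = replay s a f (suc i) (y ∷ʳ bitAt a i)

module _ {n : ℕ} (r : Reader n) (x : Vec Bool n) where

  readFrom-extends : ∀ f i (y : Vec Bool i) → ∃ λ u → readFrom r x f i y ≡ toList y ++ u
  readFrom-extends zero i y = [] , sym (ListP.++-identityʳ _)
  readFrom-extends (suc f) i y with i <? n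
  ... | no _ = [] , sym (ListP.++-identityʳ _)
  ... | yes i<n with r (fromℕ< i<n) (cast (sym (toℕ-fromℕ< i<n)) y)
  ...   | nothing = [] , sym (ListP.++-identityʳ _)
  ...   | just k with u , e ← readFrom-extends f (suc i) (y ∷ʳ lookup x k) =
    lookup x k ∷ u ,
    trans e (trans (cong (_++ u) (VecP.toList-∷ʳ (lookup x k) y)) (ListP.++-assoc (toList y) _ u))

  readFrom-length-≤ : ∀ f i (y : Vec Bool i) → i ≤ n → length (readFrom r x f i y) ≤ n
  readFrom-length-≤ zero i y i≤n = subst (_≤ n) (sym (VecP.length-toList y)) i≤n
  readFrom-length-≤ (suc f) i y i≤n with i <? n
  ... | no _ = subst (_≤ n) (sym (VecP.length-toList y)) i≤n
  ... | yes i<n with r (fromℕ< i<n) (cast (sym (toℕ-fromℕ< i<n)) y)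
  ...   | nothing = subst (_≤ n) (sym (VecP.length-toList y)) i≤n
  ...   | just k  = readFrom-length-≤ f (suc i) (y ∷ʳ lookup x k) i<n

  readFrom≡replay : ∀ a f i (y : Vec Bool i) t → readFrom r x f i y ++ t ≡ a →
                    readFrom r x f i y ≡ replay r a f i y
  readFrom≡replay a zero i y t _ = refl
  readFrom≡replay a (suc f) i y t read++t≡a with i <? n
  ... | no _ = refl
  ... | yes i<n with r (fromℕ< i<n) (cast (sym (toℕ-fromℕ< i<n)) y)
  ...   | nothing = refl
  ...   | just k = subst (λ b → readFrom r x f (suc i) (y ∷ʳ lookup x k) ≡ replay r a f (suc i) (y ∷ʳ b))
                       answer (readFrom≡replay a f (suc i) (y ∷ʳ lookup x k) t read++t≡a)
    where
    open ≡-Reasoning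
    answer : lookup x k ≡ bitAt a i
    answer with u , e ← readFrom-extends f (suc i) (y ∷ʳ lookup x k) = sym (begin
      bitAt a i
        ≡⟨ cong (λ c → bitAt c i) read++t≡a ⟨
      bitAt (readFrom r x f (suc i) (y ∷ʳ lookup x k) ++ t) i
        ≡⟨ cong (λ c → bitAt (c ++ t) i) e ⟩
      bitAt ((toList (y ∷ʳ lookup x k) ++ u) ++ t) i
        ≡⟨ cong (λ c → bitAt c i) (ListP.++-assoc (toList (y ∷ʳ lookup x k)) u t) ⟩
      bitAt (toList (y ∷ʳ lookup x k) ++ u ++ t) i
        ≡⟨ bitAt-toList-∷ʳ y (lookup x k) (u ++ t) ⟩
      lookup x k ∎)

reading≡replay : ∀ {n} {r s : Reader n} → Contains r s → ∀ x → reading s x ≡ replay s (reading r x) n 0 []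
reading≡replay {n} {r} {s} r⊇s x with t , e ← r⊇s x = readFrom≡replay s x (reading r x) n 0 [] t e

reading-length-≤ : ∀ {n} (r : Reader n) x → length (reading r x) ≤ n
reading-length-≤ {n} r x = readFrom-length-≤ r x n 0 [] z≤n

fromℚᵘ-homo-+ : ∀ p q → ℚ.fromℚᵘ (p ℚᵘ.+ q) ≡ ℚ.fromℚᵘ p + ℚ.fromℚᵘ q
fromℚᵘ-homo-+ p q = ℚP.toℚᵘ-injective (ℚᵘP.≃-trans (ℚP.toℚᵘ-fromℚᵘ (p ℚᵘ.+ q))
  (ℚᵘP.≃-trans (ℚᵘP.+-cong (ℚᵘP.≃-sym (ℚP.toℚᵘ-fromℚᵘ p)) (ℚᵘP.≃-sym (ℚP.toℚᵘ-fromℚᵘ q)))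
               (ℚᵘP.≃-sym (ℚP.toℚᵘ-homo-+ (ℚ.fromℚᵘ p) (ℚ.fromℚᵘ q)))))

frac-suc : ∀ m N → frac (suc m) N ≡ frac 1 N + frac m N
frac-suc m zero    = refl
frac-suc m (suc d) =
  trans (ℚP.fromℚᵘ-cong split) (fromℚᵘ-homo-+ (mkℚᵘ (ℤ.+ 1) d) (mkℚᵘ (ℤ.+ m) d))
  where
  split : mkℚᵘ (ℤ.+ suc m) d ℚᵘ.≃ mkℚᵘ (ℤ.+ 1) d ℚᵘ.+ mkℚᵘ (ℤ.+ m) d
  split = *≡* (trans (cong (ℤ.+ suc m ℤ.*_) (ℤP.pos-* (suc d) (suc d))) (identity (ℤ.+ m) (ℤ.+ suc d)))
    where
    identity : ∀ (a b : ℤ) → (ℤ.+ 1 ℤ.+ a) ℤ.* (b ℤ.* b) ≡ (ℤ.+ 1 ℤ.* b ℤ.+ a ℤ.* b) ℤ.* b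
    identity = solve-∀

frac-zero : ∀ N → frac 0 N ≡ 0ℚ
frac-zero zero    = refl
frac-zero (suc d) = ℚP.0/n≡0 (suc d)

frac-count : (P : A → Bool) (xs : List A) (N : ℕ) → frac (count P xs) N ≡ ∑ xs (λ x → mask (P x) (frac 1 N))
frac-count P []       N = frac-zero N
frac-count P (x ∷ xs) N with P x
... | true  = trans (frac-suc _ N) (cong (frac 1 N +_) (frac-count P xs N))
... | false = trans (frac-count P xs N) (sym (ℚP.+-identityˡ _))

mask-∧-- : ∀ c g e p q → mask (c ∧ (g ∧ e)) p - mask (g ∧ e) q ≡ mask e (mask (c ∧ g) p - mask g q)
mask-∧-- true  true  true  p q = refl
mask-∧-- true  false true  p q = refl
mask-∧-- false true  true  p q = refl
mask-∧-- false false true  p q = refl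
mask-∧-- true  true  false p q = refl
mask-∧-- true  false false p q = refl
mask-∧-- false true  false p q = refl
mask-∧-- false false false p q = refl

module _ {n : ℕ} (C : Vec Bool n → Bool) (J : Subset n) (y : Partial J) where

  #C∩y #y : ℕ
  #C∩y = count (λ c → C c ∧ agrees J y c) (allVecs n)
  #y   = count (λ c → agrees J y c) (allVecs n)

  signedWeight : Vec Bool n → ℚ
  signedWeight x = mask (C x ∧ agrees J y x) (frac 1 #C∩y) - mask (agrees J y x) (frac 1 #y)

  open Pushforward _≟ₛ_ (allVecs n) signedWeight

  probC-probS≡pushforward : ∀ h a → probC C J y h a - probS J y h a ≡ pushforward (reading h) a
  probC-probS≡pushforward h a = begin
    probC C J y h a - probS J y h a
      ≡⟨ cong₂ _-_ (frac-count _ (allVecs n) #C∩y) (frac-count _ (allVecs n) #y) ⟩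
    ∑ (allVecs n) (λ x → mask (C x ∧ agrees J y x ∧ sameString (reading h x) a) (frac 1 #C∩y))
      - ∑ (allVecs n) (λ x → mask (agrees J y x ∧ sameString (reading h x) a) (frac 1 #y))
      ≡⟨ ∑-distrib-- (allVecs n) _ _ ⟩
    ∑ (allVecs n) (λ x → mask (C x ∧ agrees J y x ∧ sameString (reading h x) a) (frac 1 #C∩y)
                          - mask (agrees J y x ∧ sameString (reading h x) a) (frac 1 #y))
      ≡⟨ ∑-cong (allVecs n) (λ x → mask-∧-- (C x) (agrees J y x) _ (frac 1 #C∩y) (frac 1 #y)) ⟩
    pushforward (reading h) a ∎
    where open ≡-Reasoning

  tvDist-mono-⊇ : {r s : Reader n} → Contains r s → tvDist C J y s ℚ.≤ tvDist C J y r
  tvDist-mono-⊇ {r} {s} r⊇s = ℚP.*-monoˡ-≤-nonNeg ½ (begin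
    ∑ (allStrings n) (λ a → ∣ probC C J y s a - probS J y s a ∣)
      ≡⟨ ∑-cong (allStrings n) (λ a → cong ∣_∣ (trans (probC-probS≡pushforward s a)
                                                       (pushforward-cong (reading≡replay r⊇s) a))) ⟩
    ∑ (allStrings n) (λ a → ∣ pushforward (replayₛ ∘ reading r) a ∣)
      ≤⟨ ∑∣pushforward-∘∣≤∑∣pushforward∣ (allStrings n) (reading r)
           (λ x → occurrences-allStrings n (reading r x) (reading-length-≤ r x)) replayₛ (occurrences-allStrings-≤1 n) ⟩
    ∑ (allStrings n) (λ b → ∣ pushforward (reading r) b ∣)
      ≡⟨ ∑-cong (allStrings n) (λ b → cong ∣_∣ (probC-probS≡pushforward r b)) ⟨
    ∑ (allStrings n) (λ a → ∣ probC C J y r a - probS J y r a ∣) ∎)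
    where
    open ℚP.≤-Reasoning
    replayₛ : List Bool → List Bool
    replayₛ b = replay s b n 0 []

mainTheorem10 : (n : ℕ) (C' : Vec Bool n → Bool) (r s : Reader n) →
    IsGeneralizedReader r → IsGeneralizedReader s → Contains r s →
    (J : Subset n) (y : Partial J) →
    Σ (Vec Bool n) (λ c → C' c ≡ true × agrees J y c ≡ true) →
    Discerning C' J y s → Discerning C' J y r
mainTheorem10 n C' r s _ _ r⊇s J y _ s-discerning = ℚP.≤-trans s-discerning (tvDist-mono-⊇ C' J y r⊇s)
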